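{- Let $\mathcal{M}$ be a minor-closed class of matroids and let (X) be one of the properties (R), (R+), (P), (P+). Suppose that for every $M\in\mathcal{M}$ with ground set $E$ and every pair $A,B$ of bases of $M$ with $A\cap B=\emptyset$ and $A\cup B=E$, the requirement of (X) holds for the pair $A,B$. Then every matroid in $\mathcal{M}$ has property (X).
   Context: For a matroid $M$ on ground set $E$ with circuit set $\mathcal{C}$ and $X\subseteq E$, $\mathcal{C}[X]=\{C\in\mathcal{C}\mid C\subseteq X\}$. A graph whose vertex set is a set of matroid elements covers a family $\mathcal{C}'$ of circuits if every $C\in\mathcal{C}'$ contains both endpoints of some edge. Graphs may have parallel edges. A matroid has property (R) if for any pair $A,B$ of bases there is a 2-regular graph with vertex set $A\triangle B$ covering $\mathcal{C}[A\cup B]$; (R+) if for any pair $A,B$ of bases there is a 2-regular graph with vertex set $A\triangle B$ consisting of cycles alternating between $A\setminus B$ and $B\setminus A$ covering $\mathcal{C}[A\cup B]$; (P) if for any pair $A,B$ of bases there is a path with vertex set $A\triangle B$ covering $\mathcal{C}[A\cup B]$; (P+) if for any pair $A,B$ of bases there is a path with vertex set $A\triangle B$ alternating between $A\setminus B$ and $B\setminus A$ covering $\mathcal{C}[A\cup B]$. -}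

module Defs where

open import Data.Nat using (ℕ; zero; suc; _+_; _<_)
open import Data.Fin using (Fin)
open import Data.Fin.Properties using (_≟_)
open import Data.Fin.Subset
  using (Subset; ⊥; ⁅_⁆; _∈_; _∉_; _⊆_; _∩_; _∪_; _─_; _-_; ∣_∣)
open import Data.Product using (Σ; ∃; ∃-syntax; _×_; _,_; proj₁; proj₂)
open import Data.Sum using (_⊎_)
open import Data.List using (List; []; _∷_)
open import Data.List.Relation.Unary.Unique.Propositional using (Unique)
open import Data.List.Membership.Propositional using () renaming (_∈_ to _∈ₗ_)
open import Relation.Nullary using (¬_; yes; no)
open import Relation.Binary.PropositionalEquality using (_≡_; _≢_)

-- Matroids, given by independent sets.
-- The ground set E is a subset of a fixed finite "universe" Fin n;
-- minors keep the same universe (ground set shrinks), so no relabelling.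

record Matroid : Set₁ where
  field
    n       : ℕ
    ground  : Subset n
    indep   : Subset n → Set
    indep⊆  : ∀ I → indep I → I ⊆ ground
    indep-∅ : indep ⊥
    indep-hered : ∀ I J → J ⊆ I → indep I → indep J
    indep-aug : ∀ I J → indep I → indep J → ∣ I ∣ < ∣ J ∣ →
                ∃[ x ] (x ∈ J × x ∉ I × indep (I ∪ ⁅ x ⁆))

open Matroid public

_△_ : ∀ {n} → Subset n → Subset n → Subset n
A △ B = (A ─ B) ∪ (B ─ A)

IsBasis : (M : Matroid) → Subset (n M) → Set
IsBasis M B = indep M B × (∀ x → x ∈ ground M → x ∉ B → ¬ indep M (B ∪ ⁅ x ⁆))

IsCircuit : (M : Matroid) → Subset (n M) → Set
IsCircuit M C = C ⊆ ground M × ¬ indep M C × (∀ x → x ∈ C → indep M (C - x))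

IsBasisOf : (M : Matroid) → Subset (n M) → Subset (n M) → Set
IsBasisOf M X I = I ⊆ X × indep M I × (∀ x → x ∈ X → x ∉ I → ¬ indep M (I ∪ ⁅ x ⁆))

-- N is a minor of M: N = M / C \ D for disjoint C, D ⊆ E(M).
-- Independent sets of M / C \ D: subsets X of E ∖ (C ∪ D) such that
-- X ∪ I is independent in M, where I is a basis of C.
IsMinor : Matroid → Matroid → Set
IsMinor N M =
  Σ (n N ≡ n M) λ { _≡_.refl →
    ∃[ C ] ∃[ D ] (C ⊆ ground M × D ⊆ ground M × C ∩ D ≡ ⊥ ×
      ground N ≡ ground M ─ (C ∪ D) ×
      (∀ X → X ⊆ ground N →
        (indep N X → ∃[ I ] (IsBasisOf M C I × indep M (X ∪ I))) ×
        (∀ I → IsBasisOf M C I → indep M (X ∪ I) → indep N X))) }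

MinorClosed : (Matroid → Set) → Set₁
MinorClosed 𝓜 = ∀ M N → 𝓜 M → IsMinor N M → 𝓜 N

Edge : ℕ → Set
Edge n = Fin n × Fin n

deg : ∀ {n} → Fin n → List (Edge n) → ℕ
deg v [] = zero
deg v ((a , b) ∷ es) = ind a + (ind b + deg v es)
  where
  ind : _ → ℕ
  ind a with a ≟ v
  ... | yes _ = 1
  ... | no _  = 0

TwoRegular : ∀ {n} → Subset n → List (Edge n) → Set
TwoRegular V es =
  (∀ e → e ∈ₗ es → proj₁ e ∈ V × proj₂ e ∈ V × proj₁ e ≢ proj₂ e) ×
  (∀ v → v ∈ V → deg v es ≡ 2)

AlternatingEdges : ∀ {n} → Subset n → Subset n → List (Edge n) → Set
AlternatingEdges A B es = ∀ e → e ∈ₗ es →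
  (proj₁ e ∈ A ─ B × proj₂ e ∈ B ─ A) ⊎ (proj₁ e ∈ B ─ A × proj₂ e ∈ A ─ B)

pathEdges : ∀ {n} → List (Fin n) → List (Edge n)
pathEdges [] = []
pathEdges (v ∷ []) = []
pathEdges (v ∷ w ∷ vs) = (v , w) ∷ pathEdges (w ∷ vs)

IsPathOn : ∀ {n} → Subset n → List (Fin n) → Set
IsPathOn V vs = Unique vs × (∀ v → (v ∈ₗ vs → v ∈ V) × (v ∈ V → v ∈ₗ vs))

Covers : (M : Matroid) → Subset (n M) → List (Edge (n M)) → Set
Covers M X es = ∀ C → IsCircuit M C → C ⊆ X →
  ∃[ e ] (e ∈ₗ es × proj₁ e ∈ C × proj₂ e ∈ C)

data Prop : Set where
  R R+ P P+ : Prop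

Req : Prop → (M : Matroid) → Subset (n M) → Subset (n M) → Set
Req R  M A B = ∃[ es ] (TwoRegular (A △ B) es × Covers M (A ∪ B) es)
Req R+ M A B = ∃[ es ] (TwoRegular (A △ B) es × AlternatingEdges A B es ×
                        Covers M (A ∪ B) es)
Req P  M A B = ∃[ vs ] (IsPathOn (A △ B) vs × Covers M (A ∪ B) (pathEdges vs))
Req P+ M A B = ∃[ vs ] (IsPathOn (A △ B) vs ×
                        AlternatingEdges A B (pathEdges vs) ×
                        Covers M (A ∪ B) (pathEdges vs))

HasProp : Prop → Matroid → Set
HasProp X M = ∀ A B → IsBasis M A → IsBasis M B → Req X M A B

{-# OPTIONS --safe #-}
-- Contract A ∩ B and delete E ∖ (A ∪ B). In the resulting minor N, whose ground set is
-- A △ B, the sets A ∖ B and B ∖ A are complementary bases, so the hypothesis yields a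
-- graph on A △ B covering every circuit of N. A circuit C of M inside A ∪ B leaves the
-- dependent set C ∩ (A △ B) in N, which contains a circuit of N and hence an edge.
module Submission where

open import Defs
open import Data.Fin.Subset using (⊥; _∩_; _∪_)
open import Relation.Binary.PropositionalEquality using (_≡_)

open import Algebra.Bundles using (CommutativeMonoid)
open import Data.Fin using (Fin; zero; suc)
open import Data.Fin.Subset using (Subset; inside; outside; ⁅_⁆; _∈_; _∉_; _⊆_; _─_; _-_; ∣_∣)
open import Data.Fin.Subset.Properties
  using (_∈?_; ⊆-refl; ⊆-trans; ⊆-antisym; ⊆-min; x∈⁅y⁆⇒x≡y;
         p⊆p∪q; q⊆p∪q; x∈p∪q⁻; p∩q⊆p; p∩q⊆q; x∈p∩q⁺; x∈p∩q⁻;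
         p─q⊆p; x∈p∧x∉q⇒x∈p─q; x∈p⇒∣p-x∣<∣p∣; ∪-identityˡ; ∪-commutativeMonoid)
open import Data.List using (List)
open import Data.List.Membership.Propositional using (find; lose) renaming (_∈_ to _∈ₗ_)
open import Data.List.Relation.Unary.Any using (any?)
open import Data.Nat using (ℕ; zero; suc; _+_; _<_)
open import Data.Nat.Induction using (<-wellFounded)
open import Data.Nat.Properties using (+-suc; +-monoˡ-<)
open import Data.Product using (∃-syntax; _×_; _,_; proj₁; proj₂)
open import Data.Sum using (_⊎_; inj₁; inj₂)
open import Data.Vec using ([]; _∷_; here; there)
open import Function using (_∘_; _on_; case_of_)
open import Induction.WellFounded using (Acc; acc)
open import Relation.Binary.Construct.On as On using ()
open import Relation.Binary.PropositionalEquality using (refl; sym; trans; cong; cong₂; subst; subst₂)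
open import Relation.Nullary using (¬_; Dec; yes; no; _×-dec_; contradiction)
open import Relation.Nullary.Decidable using (map′; decidable-stable)
open import Relation.Nullary.Negation using (¬¬-map)

infix 4 _#_

_#_ : ∀ {m} → Subset m → Subset m → Set
p # q = ∀ {x} → x ∈ p → x ∉ q

x∈p─q⇒x∉q : ∀ {m} {x : Fin m} (p q : Subset m) → x ∈ p ─ q → x ∉ q
x∈p─q⇒x∉q (inside  ∷ p) (inside ∷ q) () here
x∈p─q⇒x∉q (outside ∷ p) (inside ∷ q) () here
x∈p─q⇒x∉q (_ ∷ p) (_ ∷ q) (there x∈p─q) (there x∈q) = x∈p─q⇒x∉q p q x∈p─q x∈q

#-∷⁻ : ∀ {m s t} {p q : Subset m} → s ∷ p # t ∷ q → p # q
#-∷⁻ sp#tq x∈p = sp#tq (there x∈p) ∘ there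

∣p∪q∣≡∣p∣+∣q∣ : ∀ {m} (p q : Subset m) → p # q → ∣ p ∪ q ∣ ≡ ∣ p ∣ + ∣ q ∣
∣p∪q∣≡∣p∣+∣q∣ []            []            _   = refl
∣p∪q∣≡∣p∣+∣q∣ (inside  ∷ p) (inside  ∷ q) p#q = contradiction here (p#q here)
∣p∪q∣≡∣p∣+∣q∣ (inside  ∷ p) (outside ∷ q) p#q = cong suc (∣p∪q∣≡∣p∣+∣q∣ p q (#-∷⁻ p#q))
∣p∪q∣≡∣p∣+∣q∣ (outside ∷ p) (inside  ∷ q) p#q =
  trans (cong suc (∣p∪q∣≡∣p∣+∣q∣ p q (#-∷⁻ p#q))) (sym (+-suc ∣ p ∣ ∣ q ∣))
∣p∪q∣≡∣p∣+∣q∣ (outside ∷ p) (outside ∷ q) p#q = ∣p∪q∣≡∣p∣+∣q∣ p q (#-∷⁻ p#q)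

module _ {m : ℕ} where

  x∉p─q⇒x∈q : ∀ {x : Fin m} {p q : Subset m} → x ∈ p → x ∉ p ─ q → x ∈ q
  x∉p─q⇒x∈q {x} {q = q} x∈p x∉p─q with x ∈? q
  ... | yes x∈q = x∈q
  ... | no  x∉q = contradiction (x∈p∧x∉q⇒x∈p─q x∈p x∉q) x∉p─q

  ∪-lub : ∀ {p q r : Subset m} → p ⊆ r → q ⊆ r → p ∪ q ⊆ r
  ∪-lub {p} {q} p⊆r q⊆r x∈p∪q with x∈p∪q⁻ p q x∈p∪q
  ... | inj₁ x∈p = p⊆r x∈p
  ... | inj₂ x∈q = q⊆r x∈q

  ∪-monoˡ : ∀ {p q r : Subset m} → p ⊆ q → p ∪ r ⊆ q ∪ r
  ∪-monoˡ {q = q} {r} p⊆q = ∪-lub (p⊆p∪q r ∘ p⊆q) (q⊆p∪q q r)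

  #⇒p∩q≡⊥ : ∀ {p q : Subset m} → p # q → p ∩ q ≡ ⊥
  #⇒p∩q≡⊥ {p} {q} p#q = ⊆-antisym
    (λ x∈p∩q → let (x∈p , x∈q) = x∈p∩q⁻ p q x∈p∩q in contradiction x∈q (p#q x∈p))
    (⊆-min _)

  #⇒p─q≡p : ∀ {p q : Subset m} → p # q → p ─ q ≡ p
  #⇒p─q≡p {p} {q} p#q = ⊆-antisym (p─q⊆p p q) (λ x∈p → x∈p∧x∉q⇒x∈p─q x∈p (p#q x∈p))

  p─q#q─p : (p q : Subset m) → p ─ q # q ─ p
  p─q#q─p p q x∈p─q x∈q─p = x∈p─q⇒x∉q p q x∈p─q (p─q⊆p q p x∈q─p)

  p△q#p∩q : (p q : Subset m) → p △ q # p ∩ q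
  p△q#p∩q p q x∈p△q x∈p∩q = case x∈p∪q⁻ (p ─ q) (q ─ p) x∈p△q of λ where
    (inj₁ x∈p─q) → x∈p─q⇒x∉q p q x∈p─q (p∩q⊆q p q x∈p∩q)
    (inj₂ x∈q─p) → x∈p─q⇒x∉q q p x∈q─p (p∩q⊆p p q x∈p∩q)

  p∪q⊆p∩q∪p△q : (p q : Subset m) → p ∪ q ⊆ (p ∩ q) ∪ (p △ q)
  p∪q⊆p∩q∪p△q p q {x} x∈p∪q with x ∈? p | x ∈? q | x∈p∪q⁻ p q x∈p∪q
  ... | yes x∈p | yes x∈q | _ = p⊆p∪q (p △ q) (x∈p∩q⁺ (x∈p , x∈q))
  ... | yes x∈p | no  x∉q | _ = q⊆p∪q (p ∩ q) (p △ q) (p⊆p∪q (q ─ p) (x∈p∧x∉q⇒x∈p─q x∈p x∉q))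
  ... | no  x∉p | yes x∈q | _ = q⊆p∪q (p ∩ q) (p △ q) (q⊆p∪q (p ─ q) (q ─ p) (x∈p∧x∉q⇒x∈p─q x∈q x∉p))
  ... | no  x∉p | no  _   | inj₁ x∈p = contradiction x∈p x∉p
  ... | no  _   | no  x∉q | inj₂ x∈q = contradiction x∈q x∉q

¬¬-Π-Fin : ∀ {m} {P : Fin m → Set} → (∀ i → ¬ ¬ P i) → ¬ ¬ (∀ i → P i)
¬¬-Π-Fin {zero} _ k = k (λ ())
¬¬-Π-Fin {suc m} h k = h zero λ p₀ → ¬¬-Π-Fin (h ∘ suc) λ ps → k λ { zero → p₀ ; (suc i) → ps i }

HasEdgeIn : ∀ {m} → List (Edge m) → Subset m → Set
HasEdgeIn es C = ∃[ e ] (e ∈ₗ es × proj₁ e ∈ C × proj₂ e ∈ C)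

hasEdgeIn? : ∀ {m} (es : List (Edge m)) (C : Subset m) → Dec (HasEdgeIn es C)
hasEdgeIn? es C = map′ find (λ (_ , e∈es , ends∈C) → lose e∈es ends∈C)
  (any? (λ e → (proj₁ e ∈? C) ×-dec (proj₂ e ∈? C)) es)

module _ (M : Matroid) where

  -- Independence is not decidable, so a minimal dependent subset exists only under ¬¬;
  -- this is enough because having an edge inside a set is decidable (covers-stable).
  dependent⇒¬¬circuit : ∀ S → S ⊆ ground M → ¬ indep M S → ¬ ¬ (∃[ C ] (C ⊆ S × IsCircuit M C))
  dependent⇒¬¬circuit S₀ = go S₀ (On.wellFounded ∣_∣ <-wellFounded S₀)
    where
    go : ∀ S → Acc (_<_ on ∣_∣) S →
         S ⊆ ground M → ¬ indep M S → ¬ ¬ (∃[ C ] (C ⊆ S × IsCircuit M C))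
    go S (acc smaller) S⊆E S-dep no-circuit =
      ¬¬-Π-Fin removable λ S-minimal → no-circuit (S , ⊆-refl , S⊆E , S-dep , S-minimal)
      where
      removable : ∀ x → ¬ ¬ (x ∈ S → indep M (S - x))
      removable x not-removable with x ∈? S
      ... | no  x∉S = not-removable (λ x∈S → contradiction x∈S x∉S)
      ... | yes x∈S =
        go (S - x) (smaller (x∈p⇒∣p-x∣<∣p∣ x∈S)) (⊆-trans (p─q⊆p S ⁅ x ⁆) S⊆E)
          (λ S-x-indep → not-removable (λ _ → S-x-indep))
          (λ (C , C⊆S-x , C-circuit) → no-circuit (C , ⊆-trans C⊆S-x (p─q⊆p S ⁅ x ⁆) , C-circuit))

  covers-stable : ∀ X es → (∀ C → IsCircuit M C → C ⊆ X → ¬ ¬ HasEdgeIn es C) → Covers M X es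
  covers-stable X es ¬¬covers C C-circuit C⊆X =
    decidable-stable (hasEdgeIn? es C) (¬¬covers C C-circuit C⊆X)

  basisOf-indep : ∀ {K I} → indep M K → IsBasisOf M K I → I ≡ K
  basisOf-indep {K} {I} K-indep (I⊆K , _ , I-maximal) = ⊆-antisym I⊆K K⊆I
    where
    K⊆I : K ⊆ I
    K⊆I {x} x∈K with x ∈? I
    ... | yes x∈I = x∈I
    ... | no  x∉I = contradiction
      (indep-hered M K (I ∪ ⁅ x ⁆) (∪-lub I⊆K (λ y∈⁅x⁆ → subst (_∈ K) (sym (x∈⁅y⁆⇒x≡y x y∈⁅x⁆)) x∈K)) K-indep)
      (I-maximal x x∈K x∉I)

module Contraction (M : Matroid) {K G : Subset (n M)}
  (K-indep : indep M K) (G⊆E : G ⊆ ground M) (G#K : G # K) where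

  open import Algebra.Properties.CommutativeSemigroup
    (CommutativeMonoid.commutativeSemigroup (∪-commutativeMonoid (n M)))
    using (xy∙z≈xz∙y)

  private
    E : Subset (n M)
    E = ground M

  indep/K : Subset (n M) → Set
  indep/K X = X ⊆ G × indep M (X ∪ K)

  augment/K : ∀ I J → indep/K I → indep/K J → ∣ I ∣ < ∣ J ∣ →
              ∃[ x ] (x ∈ J × x ∉ I × indep/K (I ∪ ⁅ x ⁆))
  augment/K I J (I⊆G , I∪K-indep) (J⊆G , J∪K-indep) ∣I∣<∣J∣
    with indep-aug M (I ∪ K) (J ∪ K) I∪K-indep J∪K-indep ∣I∪K∣<∣J∪K∣
    where
    ∣I∪K∣<∣J∪K∣ : ∣ I ∪ K ∣ < ∣ J ∪ K ∣
    ∣I∪K∣<∣J∪K∣ rewrite ∣p∪q∣≡∣p∣+∣q∣ I K (G#K ∘ I⊆G) | ∣p∪q∣≡∣p∣+∣q∣ J K (G#K ∘ J⊆G) =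
      +-monoˡ-< ∣ K ∣ ∣I∣<∣J∣
  ... | x , x∈J∪K , x∉I∪K , I∪K∪x-indep with x∈p∪q⁻ J K x∈J∪K
  ...   | inj₂ x∈K = contradiction (q⊆p∪q I K x∈K) x∉I∪K
  ...   | inj₁ x∈J = x , x∈J , x∉I∪K ∘ p⊆p∪q K ,
    ∪-lub I⊆G (λ y∈⁅x⁆ → subst (_∈ G) (sym (x∈⁅y⁆⇒x≡y x y∈⁅x⁆)) (J⊆G x∈J)) ,
    subst (indep M) (sym (xy∙z≈xz∙y I ⁅ x ⁆ K)) I∪K∪x-indep

  M/K↾G : Matroid
  M/K↾G = record
    { n           = n M
    ; ground      = G
    ; indep       = indep/K
    ; indep⊆      = λ _ → proj₁
    ; indep-∅     = ⊆-min G , subst (indep M) (sym (∪-identityˡ K)) K-indep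
    ; indep-hered = λ I J J⊆I (I⊆G , I∪K-indep) →
        ⊆-trans J⊆I I⊆G , indep-hered M (I ∪ K) (J ∪ K) (∪-monoˡ J⊆I) I∪K-indep
    ; indep-aug   = augment/K
    }

  M/K↾G-isMinor : IsMinor M/K↾G M
  M/K↾G-isMinor = refl , K , D , indep⊆ M K K-indep , p─q⊆p E (K ∪ G) ,
    #⇒p∩q≡⊥ (λ x∈K x∈D → x∈p─q⇒x∉q E (K ∪ G) x∈D (p⊆p∪q G x∈K)) , G≡E─K∪D ,
    λ X X⊆G →
      (λ (_ , X∪K-indep) → K , K-basisOf-K , X∪K-indep) ,
      (λ I I-basisOf-K X∪I-indep →
         X⊆G , subst (λ I → indep M (X ∪ I)) (basisOf-indep M K-indep I-basisOf-K) X∪I-indep)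
    where
    D : Subset (n M)
    D = E ─ (K ∪ G)
    K-basisOf-K : IsBasisOf M K K
    K-basisOf-K = ⊆-refl , K-indep , λ _ x∈K x∉K → contradiction x∈K x∉K
    G≡E─K∪D : G ≡ E ─ (K ∪ D)
    G≡E─K∪D = ⊆-antisym G⊆E─K∪D E─K∪D⊆G
      where
      G⊆E─K∪D : G ⊆ E ─ (K ∪ D)
      G⊆E─K∪D {x} x∈G = x∈p∧x∉q⇒x∈p─q (G⊆E x∈G) λ x∈K∪D → case x∈p∪q⁻ K D x∈K∪D of λ where
        (inj₁ x∈K) → G#K x∈G x∈K
        (inj₂ x∈D) → x∈p─q⇒x∉q E (K ∪ G) x∈D (q⊆p∪q K G x∈G)
      E─K∪D⊆G : E ─ (K ∪ D) ⊆ G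
      E─K∪D⊆G {x} x∈E─K∪D = case x∈p∪q⁻ K G x∈K∪G of λ where
          (inj₁ x∈K) → contradiction (p⊆p∪q D x∈K) x∉K∪D
          (inj₂ x∈G) → x∈G
        where
        x∉K∪D : x ∉ K ∪ D
        x∉K∪D = x∈p─q⇒x∉q E (K ∪ D) x∈E─K∪D
        x∈K∪G : x ∈ K ∪ G
        x∈K∪G = x∉p─q⇒x∈q (p─q⊆p E (K ∪ D) x∈E─K∪D) (x∉K∪D ∘ q⊆p∪q K D)

  basis-contract : ∀ {Y Y'} → IsBasis M Y → K ⊆ Y → Y' ⊆ Y → Y' ⊆ G →
                   (∀ {y} → y ∈ Y → y ∉ Y' → y ∈ K) → IsBasis M/K↾G Y'
  basis-contract {Y} {Y'} (Y-indep , Y-maximal) K⊆Y Y'⊆Y Y'⊆G Y─Y'⊆K =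
    (Y'⊆G , indep-hered M Y (Y' ∪ K) (∪-lub Y'⊆Y K⊆Y) Y-indep) ,
    λ x x∈G x∉Y' (_ , Y'∪x∪K-indep) →
      Y-maximal x (G⊆E x∈G) (λ x∈Y → G#K x∈G (Y─Y'⊆K x∈Y x∉Y'))
        (indep-hered M ((Y' ∪ ⁅ x ⁆) ∪ K) (Y ∪ ⁅ x ⁆)
          (∪-lub (Y⊆Y'∪x∪K x) (p⊆p∪q K ∘ q⊆p∪q Y' ⁅ x ⁆)) Y'∪x∪K-indep)
    where
    Y⊆Y'∪x∪K : ∀ x → Y ⊆ (Y' ∪ ⁅ x ⁆) ∪ K
    Y⊆Y'∪x∪K x {y} y∈Y with y ∈? Y'
    ... | yes y∈Y' = p⊆p∪q K (p⊆p∪q ⁅ x ⁆ y∈Y')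
    ... | no  y∉Y' = q⊆p∪q (Y' ∪ ⁅ x ⁆) K (Y─Y'⊆K y∈Y y∉Y')

  covers-lift : ∀ {X} es → X ⊆ K ∪ G → Covers M/K↾G G es → Covers M X es
  covers-lift {X} es X⊆K∪G covers = covers-stable M X es λ C (_ , C-dep , _) C⊆X →
    ¬¬-map (λ (C' , C'⊆C∩G , C'-circuit) → edge-in C' C'⊆C∩G C'-circuit)
      (dependent⇒¬¬circuit M/K↾G (C ∩ G) (p∩q⊆q C G) (C∩G-dep C C-dep C⊆X))
    where
    C∩G-dep : ∀ C → ¬ indep M C → C ⊆ X → ¬ indep/K (C ∩ G)
    C∩G-dep C C-dep C⊆X (_ , C∩G∪K-indep) =
      C-dep (indep-hered M ((C ∩ G) ∪ K) C C⊆C∩G∪K C∩G∪K-indep)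
      where
      C⊆C∩G∪K : C ⊆ (C ∩ G) ∪ K
      C⊆C∩G∪K y∈C = case x∈p∪q⁻ K G (X⊆K∪G (C⊆X y∈C)) of λ where
        (inj₁ y∈K) → q⊆p∪q (C ∩ G) K y∈K
        (inj₂ y∈G) → p⊆p∪q K (x∈p∩q⁺ (y∈C , y∈G))
    edge-in : ∀ {C} C' → C' ⊆ C ∩ G → IsCircuit M/K↾G C' → HasEdgeIn es C
    edge-in {C} C' C'⊆C∩G C'-circuit =
      let (e , e∈es , u∈C' , v∈C') = covers C' C'-circuit (proj₁ C'-circuit)
      in e , e∈es , p∩q⊆p C G (C'⊆C∩G u∈C') , p∩q⊆p C G (C'⊆C∩G v∈C')

AlternatingEdges-resp : ∀ {m} {A B A' B' : Subset m} {es} → A' ─ B' ≡ A ─ B → B' ─ A' ≡ B ─ A →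
                        AlternatingEdges A' B' es → AlternatingEdges A B es
AlternatingEdges-resp {es = es} = subst₂ (λ U W → ∀ e → e ∈ₗ es →
  (proj₁ e ∈ U × proj₂ e ∈ W) ⊎ (proj₁ e ∈ W × proj₂ e ∈ U))

module BasisPair (M : Matroid) {A B : Subset (n M)} (A-basis : IsBasis M A) (B-basis : IsBasis M B) where

  A△B⊆E : A △ B ⊆ ground M
  A△B⊆E = ∪-lub (indep⊆ M A (proj₁ A-basis) ∘ p─q⊆p A B) (indep⊆ M B (proj₁ B-basis) ∘ p─q⊆p B A)

  open Contraction M (indep-hered M A (A ∩ B) (p∩q⊆p A B) (proj₁ A-basis)) A△B⊆E (p△q#p∩q A B) public

  A─B-basis : IsBasis M/K↾G (A ─ B)
  A─B-basis = basis-contract A-basis (p∩q⊆p A B) (p─q⊆p A B) (p⊆p∪q (B ─ A))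
    (λ x∈A x∉A─B → x∈p∩q⁺ (x∈A , x∉p─q⇒x∈q x∈A x∉A─B))

  B─A-basis : IsBasis M/K↾G (B ─ A)
  B─A-basis = basis-contract B-basis (p∩q⊆q A B) (p─q⊆p B A) (q⊆p∪q (A ─ B) (B ─ A))
    (λ x∈B x∉B─A → x∈p∩q⁺ (x∉p─q⇒x∈q x∈B x∉B─A , x∈B))

  A─B─[B─A]≡A─B : (A ─ B) ─ (B ─ A) ≡ A ─ B
  A─B─[B─A]≡A─B = #⇒p─q≡p (p─q#q─p A B)

  B─A─[A─B]≡B─A : (B ─ A) ─ (A ─ B) ≡ B ─ A
  B─A─[A─B]≡B─A = #⇒p─q≡p (p─q#q─p B A)

  △-resp : (A ─ B) △ (B ─ A) ≡ A △ B
  △-resp = cong₂ _∪_ A─B─[B─A]≡A─B B─A─[A─B]≡B─A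

  req-lift : ∀ X → Req X M/K↾G (A ─ B) (B ─ A) → Req X M A B
  req-lift R (es , regular , covers) =
    es , subst (λ V → TwoRegular V es) △-resp regular , covers-lift es (p∪q⊆p∩q∪p△q A B) covers
  req-lift R+ (es , regular , alternating , covers) =
    es , subst (λ V → TwoRegular V es) △-resp regular ,
    AlternatingEdges-resp A─B─[B─A]≡A─B B─A─[A─B]≡B─A alternating , covers-lift es (p∪q⊆p∩q∪p△q A B) covers
  req-lift P (vs , path , covers) =
    vs , subst (λ V → IsPathOn V vs) △-resp path , covers-lift (pathEdges vs) (p∪q⊆p∩q∪p△q A B) covers
  req-lift P+ (vs , path , alternating , covers) =
    vs , subst (λ V → IsPathOn V vs) △-resp path ,
    AlternatingEdges-resp A─B─[B─A]≡A─B B─A─[A─B]≡B─A alternating ,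
    covers-lift (pathEdges vs) (p∪q⊆p∩q∪p△q A B) covers

lemma13 : (𝓜 : Matroid → Set) → MinorClosed 𝓜 → (X : Prop) →
    (∀ M → 𝓜 M → ∀ A B → IsBasis M A → IsBasis M B →
      A ∩ B ≡ ⊥ → A ∪ B ≡ ground M → Req X M A B) →
    ∀ M → 𝓜 M → HasProp X M
lemma13 𝓜 𝓜-minorClosed X complementary-case M M∈𝓜 A B A-basis B-basis =
  req-lift X (complementary-case M/K↾G (𝓜-minorClosed M M/K↾G M∈𝓜 M/K↾G-isMinor)
    (A ─ B) (B ─ A) A─B-basis B─A-basis (#⇒p∩q≡⊥ (p─q#q─p A B)) refl)
  where open BasisPair M A-basis B-basis
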